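{- Suppose every source symbol probability can be written using at most $b$ bits, i.e. $p(a_i)=P_i2^{ -b}$ with $P_i$ an integer, $0\le P_i\le 2^b$. Let $i\in\{0,\dots,|S|-2\}$ and let $t_i$ be any type-$i$ parse tree of an AIVF code having exactly $D$ codewords. Then each transition probability $q_j(t_i)$, $j\in\{0,\dots,|S|-2\}$, and the cost $\mathcal L(t_i)=D-E[L_{t_i}(S)]$ can be encoded using at most $O(Db)$ bits.
   Context: The source is stationary memoryless over $S=\{a_0,\dots,a_{|S|-1}\}$ with $p(a_0)\ge\dots\ge p(a_{|S|-1})$. A type-$i$ parse tree $t_i$ is a rooted tree with edges labeled by source symbols, where a node with $j$ children is $v_j$, satisfying: (p1) the root has $j$ children with $1\le j\le |S|-i$, with edges labeled by distinct $a_i,\dots,a_{i+j-1}$; (p2) leaves have $0$ children; (p3) a non-root internal node has $j$ children with $1\le j\le |S|-2$ or $j=|S|$, with edges labeled by distinct $a_0,\dots,a_{j-1}$. Every non-root node with $0\le j\le |S|-2$ children receives a codeword and its path string is placed in $\mathcal D_{i,j}$; if the root has $j<|S|-i$ children, the empty string $\lambda$ receives a codeword and is placed in $\mathcal D_{i,i+j}$; $\mathcal D(t_i)=\bigcup_j\mathcal D_{i,j}$ (disjoint). For $w=c_1\cdots c_n$, $p_W(w)=\prod_kp(c_k)$; $p_{W_i}(\lambda)=1$ and $p_{W_i}(w)=p_W(w)/\sum_{u=i}^{|S|-1}p(a_u)$ otherwise. For $w\in\mathcal D(t_i)$, $p_{C_i}(w)=p_{W_i}(w)-\sum p_{W_i}(wa)$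 over symbols $a$ with $wa$ a prefix of some word of $\mathcal D(t_i)$. Then $E[L_{t_i}(S)]=\sum_{w\in\mathcal D(t_i)}p_{C_i}(w)\,l(w)$ with $l(w)$ the length of $w$, and $q_j(t_i)=\sum_{w\in\mathcal D_{i,j}}p_{C_i}(w)$. -}

module Defs where

open import Data.Nat as ℕ using (ℕ; zero; suc; _≤_; _<_; _∸_; _^_; _≤ᵇ_; _<ᵇ_; _≡ᵇ_)
open import Data.Nat.Logarithm using (⌈log₂_⌉)
open import Data.Nat.ListAction using (sum)
open import Data.Integer as ℤ using (ℤ; +_; -[1+_])
open import Data.Rational as ℚ using (ℚ; mkℚ; 0ℚ; 1ℚ; _/_; 1/_; ↥_; ↧ₙ_)
open import Data.Fin as Fin using (Fin; toℕ)
open import Data.Bool using (Bool; true; false; if_then_else_; _∧_; _∨_)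
open import Data.List as List using (List; []; _∷_; _++_; [_]; length; map; upTo; allFin; foldr; filterᵇ)
open import Data.List.Relation.Binary.Permutation.Propositional using (_↭_)
open import Data.Product using (_×_; _,_; proj₁; proj₂)
open import Data.Sum using (_⊎_)
open import Data.Unit using (⊤)
open import Relation.Binary.PropositionalEquality using (_≡_)
open import Relation.Nullary using (does)

-- Source alphabet S = {a_0,…,a_{n-1}} is Fin n; probabilities
-- p(a_k) = P k · 2^{-b}.

Word : ℕ → Set
Word n = List (Fin n)

-- total division of an integer by a natural; (x ÷ 0 := 0, never used
-- in the statement since all divisors are assumed/proved nonzero)
divℕ : ℤ → ℕ → ℚ
divℕ z zero    = 0ℚ
divℕ z (suc m) = z / suc m

-- total reciprocal on ℚ (1/0 := 0; only used on nonzero arguments)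
inv : ℚ → ℚ
inv p@(mkℚ (+ zero) _ _)    = 0ℚ
inv p@(mkℚ (+ suc _) _ _)   = 1/ p
inv p@(mkℚ -[1+ _ ] _ _)    = 1/ p

sumℚ : List ℚ → ℚ
sumℚ = foldr ℚ._+_ 0ℚ

prodℚ : List ℚ → ℚ
prodℚ = foldr ℚ._*_ 1ℚ

prob : ∀ {n} → (b : ℕ) → (P : Fin n → ℕ) → Fin n → ℚ
prob b P k = divℕ (+ P k) (2 ^ b)

tailProb : ∀ {n} → (b : ℕ) → (P : Fin n → ℕ) → ℕ → ℚ
tailProb {n} b P i = sumℚ (map (prob b P) (filterᵇ (λ u → i ≤ᵇ toℕ u) (allFin n)))

tailSum : ∀ {n} → (P : Fin n → ℕ) → ℕ → ℕ
tailSum {n} P i = sum (map P (filterᵇ (λ u → i ≤ᵇ toℕ u) (allFin n)))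

data Tree (n : ℕ) : Set where
  node : List (Fin n × Tree n) → Tree n

labels : ∀ {n} → List (Fin n × Tree n) → List ℕ
labels cs = map (λ c → toℕ (proj₁ c)) cs

-- (p2),(p3): a non-root node has j children with j = 0 (leaf),
-- 1 ≤ j ≤ |S|-2, or j = |S|; its edges are labelled by distinct
-- a_0,…,a_{j-1}.
mutual
  NonRootOK : ∀ {n} → Tree n → Set
  NonRootOK {n} (node cs) =
    ((length cs ≤ n ∸ 2) ⊎ (length cs ≡ n))
    × (labels cs ↭ upTo (length cs))
    × AllOK cs

  AllOK : ∀ {n} → List (Fin n × Tree n) → Set
  AllOK []             = ⊤
  AllOK ((a , t) ∷ cs) = NonRootOK t × AllOK cs

IsParseTree : ∀ {n} → ℕ → Tree n → Set
IsParseTree {n} i (node cs) =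
  (1 ≤ length cs) × (length cs ≤ n ∸ i)
  × (labels cs ↭ map (λ k → i ℕ.+ k) (upTo (length cs)))
  × AllOK cs

-- Dictionary 𝒟(t_i): list of (word w, index j) meaning w ∈ 𝒟_{i,j}.

mutual
  dictNode : ∀ {n} → Word n → Tree n → List (Word n × ℕ)
  dictNode {n} w (node cs) =
    (if length cs ≤ᵇ n ∸ 2 then [ (w , length cs) ] else [])
    ++ dictChildren w cs

  dictChildren : ∀ {n} → Word n → List (Fin n × Tree n) → List (Word n × ℕ)
  dictChildren w []             = []
  dictChildren w ((a , t) ∷ cs) = dictNode (w ++ [ a ]) t ++ dictChildren w cs

dict : ∀ {n} → ℕ → Tree n → List (Word n × ℕ)
dict {n} i (node cs) =
  (if length cs <ᵇ n ∸ i then [ ([] , i ℕ.+ length cs) ] else [])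
  ++ dictChildren [] cs

numCodewords : ∀ {n} → ℕ → Tree n → ℕ
numCodewords i t = length (dict i t)

eqFin : ∀ {n} → Fin n → Fin n → Bool
eqFin x y = does (x Fin.≟ y)

isPrefix : ∀ {n} → Word n → Word n → Bool
isPrefix []       _        = true
isPrefix (x ∷ xs) []       = false
isPrefix (x ∷ xs) (y ∷ ys) = eqFin x y ∧ isPrefix xs ys

isPrefixOfSome : ∀ {n} → Word n → List (Word n × ℕ) → Bool
isPrefixOfSome w ds = foldr (λ d acc → isPrefix w (proj₁ d) ∨ acc) false ds

pW : ∀ {n} → (b : ℕ) → (P : Fin n → ℕ) → Word n → ℚ
pW b P w = prodℚ (map (prob b P) w)

pWi : ∀ {n} → (b : ℕ) → (P : Fin n → ℕ) → ℕ → Word n → ℚ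
pWi b P i []      = 1ℚ
pWi b P i (c ∷ w) = pW b P (c ∷ w) ℚ.* inv (tailProb b P i)

pCi : ∀ {n} → (b : ℕ) → (P : Fin n → ℕ) → ℕ → Tree n → Word n → ℚ
pCi {n} b P i t w =
  pWi b P i w ℚ.-
  sumℚ (map (λ a → pWi b P i (w ++ [ a ]))
            (filterᵇ (λ a → isPrefixOfSome (w ++ [ a ]) (dict i t)) (allFin n)))

ℕtoℚ : ℕ → ℚ
ℕtoℚ m = + m / 1

expectedLength : ∀ {n} → (b : ℕ) → (P : Fin n → ℕ) → ℕ → Tree n → ℚ
expectedLength b P i t =
  sumℚ (map (λ d → pCi b P i t (proj₁ d) ℚ.* ℕtoℚ (length (proj₁ d))) (dict i t))

q : ∀ {n} → (b : ℕ) → (P : Fin n → ℕ) → ℕ → Tree n → ℕ → ℚ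
q b P i t j =
  sumℚ (map (λ d → pCi b P i t (proj₁ d))
            (filterᵇ (λ d → proj₂ d ≡ᵇ j) (dict i t)))

cost : ∀ {n} → (b : ℕ) → (P : Fin n → ℕ) → ℕ → Tree n → ℚ
cost b P i t = ℕtoℚ (numCodewords i t) ℚ.- expectedLength b P i t

bitLength : ℕ → ℕ
bitLength m = ⌈log₂ (suc m) ⌉

bits : ℚ → ℕ
bits x = bitLength (ℤ.∣ ↥ x ∣) ℕ.+ bitLength (↧ₙ x)

{-# OPTIONS --safe #-}

-- All rationals occurring in q_j(t_i) and E[L] are integer multiples of 1/M, where
-- M = 2^(bD) T_i and T_i = Σ_{u ≥ i} P_u: indeed p_{W_i}(c_1⋯c_l) = P_{c_1}⋯P_{c_l} 2^b / (2^(bl) T_i),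
-- and no dictionary word is longer than D, since every child subtree of a parse tree carries
-- a codeword and a non-root node without codeword has at least two children. Over M the
-- numerator of p_{W_i}(w) is at most 2^(b(D+1)), and so is that of the sum over the children
-- of w because Σ_a P_a ≤ 2^b; hence the numerators of q_j and 𝓛 are at most
-- poly(D) 2^(b(D+1)). Reducing a fraction z/M only shrinks |z| and M, so both take O(Db) bits.
module Submission where

open import Defs
open import Data.Nat using (ℕ; _≤_; _<_; _*_; _+_; _∸_; _^_)
open import Data.Fin using (Fin; toℕ)
open import Data.List using (map; allFin)
open import Data.Nat.ListAction using (sum)
open import Data.Product using (Σ; _×_)
open import Relation.Binary.PropositionalEquality using (_≡_)

open import Data.Nat using (zero; suc; s≤s; s≤s⁻¹; z≤n; NonZero; >-nonZero; _≤ᵇ_; _<ᵇ_)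
import Data.Nat.Properties as ℕ
import Data.Nat.Coprimality as Coprime
open import Data.Nat.Divisibility using (_∣_; _∣?_; divides; ∣⇒≤)
open import Data.Nat.Logarithm using (⌈log₂⌉-mono-≤; ⌈log₂2^n⌉≡n)
open import Data.Nat.ListAction using (product)
open import Data.Nat.ListAction.Properties using (product-++)
import Data.Nat.Tactic.RingSolver as ℕ-Solver
open import Data.Integer as ℤ using (ℤ; +_; +[1+_])
import Data.Integer.Properties as ℤ
import Data.Integer.Tactic.RingSolver as ℤ-Solver
open import Data.Rational as ℚ using (ℚ; mkℚ; ↥_; ↧_; ↧ₙ_; toℚᵘ; 0ℚ; 1ℚ)
open import Data.Rational.Properties using (toℚᵘ-homo-+; toℚᵘ-homo-*; toℚᵘ-homo‿-; toℚᵘ-fromℚᵘ)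
open import Data.Rational.Unnormalised as ℚᵘ using (mkℚᵘ; *≡*) renaming (_≃_ to _≃ᵘ_)
import Data.Rational.Unnormalised.Properties as ℚᵘ
open import Data.Bool using (Bool; true; false; T; T?)
open import Data.Bool.Properties using (T-∧; T-∨)
open import Data.List using (List; []; _∷_; [_]; _++_; length; filterᵇ)
open import Data.List.Properties using (length-++; map-++; length-filter)
open import Data.List.Relation.Unary.All as All using (All; []; _∷_)
open import Data.List.Relation.Unary.All.Properties using (++⁺; all-filter; filter⁺)
open import Data.Product using (∃-syntax; _,_; proj₁; proj₂)
open import Data.Sum using (_⊎_; inj₁; inj₂)
open import Function using (Equivalence)
open import Relation.Binary.PropositionalEquality
  using (refl; sym; trans; cong; cong₂; subst; subst₂; module ≡-Reasoning)
open import Relation.Nullary using (contradiction)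
open import Relation.Nullary.Decidable using (recompute)

module Fractions where

  private variable
    A : Set
    x y : ℚ
    z z₁ z₂ : ℤ
    m M N Z Z₁ Z₂ : ℕ

  infix 4 _≐_/_ _≲_/_

  record _≐_/_ (x : ℚ) (z : ℤ) (M : ℕ) : Set where
    constructor cross
    field cross-eq : ↥ x ℤ.* + M ≡ z ℤ.* ↧ x

  private
    ≐⇒≃ᵘ : x ≐ z / suc m → toℚᵘ x ≃ᵘ mkℚᵘ z m
    ≐⇒≃ᵘ {mkℚ _ _ _} (cross eq) = *≡* eq

    ≃ᵘ⇒≐ : toℚᵘ x ≃ᵘ mkℚᵘ z m → x ≐ z / suc m
    ≃ᵘ⇒≐ {mkℚ _ _ _} (*≡* eq) = cross eq

    mkℚᵘ-+ : ∀ z₁ z₂ m → mkℚᵘ z₁ m ℚᵘ.+ mkℚᵘ z₂ m ≃ᵘ mkℚᵘ (z₁ ℤ.+ z₂) m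
    mkℚᵘ-+ z₁ z₂ m = *≡* (begin
      (z₁ ℤ.* d ℤ.+ z₂ ℤ.* d) ℤ.* d  ≡⟨ distrib z₁ z₂ d ⟩
      (z₁ ℤ.+ z₂) ℤ.* (d ℤ.* d)      ≡⟨ cong ((z₁ ℤ.+ z₂) ℤ.*_) (ℤ.pos-* (suc m) (suc m)) ⟨
      (z₁ ℤ.+ z₂) ℤ.* + (suc m * suc m) ∎)
      where
      open ≡-Reasoning
      d = + suc m
      distrib : ∀ a b c → (a ℤ.* c ℤ.+ b ℤ.* c) ℤ.* c ≡ (a ℤ.+ b) ℤ.* (c ℤ.* c)
      distrib = ℤ-Solver.solve-∀

  ≐-+ : .{{NonZero M}} → x ≐ z₁ / M → y ≐ z₂ / M → x ℚ.+ y ≐ z₁ ℤ.+ z₂ / M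
  ≐-+ {M = suc m} {x} {z₁} {y} {z₂} p q = ≃ᵘ⇒≐ (begin
    toℚᵘ (x ℚ.+ y)            ≈⟨ toℚᵘ-homo-+ x y ⟩
    toℚᵘ x ℚᵘ.+ toℚᵘ y        ≈⟨ ℚᵘ.+-cong (≐⇒≃ᵘ p) (≐⇒≃ᵘ q) ⟩
    mkℚᵘ z₁ m ℚᵘ.+ mkℚᵘ z₂ m  ≈⟨ mkℚᵘ-+ z₁ z₂ m ⟩
    mkℚᵘ (z₁ ℤ.+ z₂) m        ∎)
    where open ℚᵘ.≃-Reasoning

  ≐-neg : .{{NonZero M}} → x ≐ z / M → ℚ.- x ≐ ℤ.- z / M
  ≐-neg {M = suc m} {x} p = ≃ᵘ⇒≐ (ℚᵘ.≃-trans (toℚᵘ-homo‿- x) (ℚᵘ.-‿cong (≐⇒≃ᵘ p)))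

  ≐-- : .{{NonZero M}} → x ≐ z₁ / M → y ≐ z₂ / M → x ℚ.- y ≐ z₁ ℤ.- z₂ / M
  ≐-- p q = ≐-+ p (≐-neg q)

  ≐-* : .{{NonZero M}} → .{{NonZero N}} →
        x ≐ z₁ / M → y ≐ z₂ / N → x ℚ.* y ≐ z₁ ℤ.* z₂ / M * N
  ≐-* {M = suc _} {N = suc _} {x} {y = y} p q =
    ≃ᵘ⇒≐ (ℚᵘ.≃-trans (toℚᵘ-homo-* x y) (ℚᵘ.*-cong (≐⇒≃ᵘ p) (≐⇒≃ᵘ q)))

  ≐-rescale : ∀ K → x ≐ z / M → x ≐ z ℤ.* + K / M * K
  ≐-rescale {x} {z} {M} K (cross eq) = cross (begin
    ↥ x ℤ.* + (M * K)        ≡⟨ cong (↥ x ℤ.*_) (ℤ.pos-* M K) ⟩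
    ↥ x ℤ.* (+ M ℤ.* + K)    ≡⟨ ℤ.*-assoc (↥ x) (+ M) (+ K) ⟨
    ↥ x ℤ.* + M ℤ.* + K      ≡⟨ cong (ℤ._* + K) eq ⟩
    z ℤ.* ↧ x ℤ.* + K        ≡⟨ swap z (↧ x) (+ K) ⟩
    z ℤ.* + K ℤ.* ↧ x        ∎)
    where
    open ≡-Reasoning
    swap : ∀ a b c → a ℤ.* b ℤ.* c ≡ a ℤ.* c ℤ.* b
    swap = ℤ-Solver.solve-∀

  ≐-expand : ∀ M → x ≐ + m / 1 → x ≐ + (m * M) / M
  ≐-expand {x} {m} M p =
    subst₂ (λ z N → x ≐ z / N) (sym (ℤ.pos-* m M)) (ℕ.*-identityˡ M) (≐-rescale M p)

  divℕ-≐ : .{{NonZero N}} → divℕ z N ≐ z / N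
  divℕ-≐ {N = suc n} {z} = ≃ᵘ⇒≐ (toℚᵘ-fromℚᵘ (mkℚᵘ z n))

  ℕtoℚ-≐ : ℕtoℚ m ≐ + m / 1
  ℕtoℚ-≐ = divℕ-≐

  1ℚ-≐ : 1ℚ ≐ + 1 / 1
  1ℚ-≐ = cross refl

  0ℚ-≐ : 0ℚ ≐ + 0 / M
  0ℚ-≐ = cross refl

  -- The cross equation rules out y ≤ 0, so only a positive numerator needs a clause.
  inv-≐ : .{{NonZero N}} → .{{NonZero M}} → y ≐ + M / N → inv y ≐ + N / M
  inv-≐ {N = suc e} {M = suc t} {mkℚ +[1+ k ] d _} (cross eq) =
    cross (trans (ℤ.*-comm (+ suc d) (+ suc t)) (trans (sym eq) (ℤ.*-comm +[1+ k ] (+ suc e))))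

  ≐-abs : x ≐ z / M → ℤ.∣ ↥ x ∣ * M ≡ ℤ.∣ z ∣ * ↧ₙ x
  ≐-abs {x} {z} {M} (cross eq) =
    trans (sym (ℤ.abs-* (↥ x) (+ M))) (trans (cong ℤ.∣_∣ eq) (ℤ.abs-* z (↧ x)))

  ≐-denominator∣ : x ≐ z / M → ↧ₙ x ∣ M
  ≐-denominator∣ {mkℚ _ _ coprime} {z} {M} p =
    recompute (_ ∣? M) (Coprime.coprime-divisor (Coprime.sym coprime) (divides ℤ.∣ z ∣ (≐-abs p)))

  ≐-denominator : .{{NonZero M}} → x ≐ z / M → ↧ₙ x ≤ M
  ≐-denominator p = ∣⇒≤ (≐-denominator∣ p)

  ≐-numerator : .{{NonZero M}} → x ≐ z / M → ℤ.∣ ↥ x ∣ ≤ ℤ.∣ z ∣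
  ≐-numerator {M} {x} {z} p = ℕ.*-cancelʳ-≤ ℤ.∣ ↥ x ∣ ℤ.∣ z ∣ M (begin
    ℤ.∣ ↥ x ∣ * M  ≡⟨ ≐-abs p ⟩
    ℤ.∣ z ∣ * ↧ₙ x ≤⟨ ℕ.*-monoʳ-≤ ℤ.∣ z ∣ (≐-denominator p) ⟩
    ℤ.∣ z ∣ * M    ∎)
    where open ℕ.≤-Reasoning

  sumℚ-≐ : .{{NonZero M}} → (f : A → ℚ) (g : A → ℕ) {xs : List A} →
           All (λ a → f a ≐ + g a / M) xs → sumℚ (map f xs) ≐ + sum (map g xs) / M
  sumℚ-≐ f g []                = 0ℚ-≐
  sumℚ-≐ {M} f g {a ∷ xs} (p ∷ ps) =
    subst (λ z → sumℚ (map f (a ∷ xs)) ≐ z / M) (sym (ℤ.pos-+ (g a) (sum (map g xs))))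
      (≐-+ p (sumℚ-≐ f g ps))

  _≲_/_ : ℚ → ℕ → ℕ → Set
  x ≲ Z / M = ∃[ z ] ℤ.∣ z ∣ ≤ Z × x ≐ z / M

  ≐⇒≲ : x ≐ + m / M → x ≲ m / M
  ≐⇒≲ {m = m} p = + m , ℕ.≤-refl , p

  ≲-weaken : Z₁ ≤ Z₂ → x ≲ Z₁ / M → x ≲ Z₂ / M
  ≲-weaken Z₁≤Z₂ (z , ∣z∣≤Z₁ , p) = z , ℕ.≤-trans ∣z∣≤Z₁ Z₁≤Z₂ , p

  ≲-+ : .{{NonZero M}} → x ≲ Z₁ / M → y ≲ Z₂ / M → x ℚ.+ y ≲ Z₁ + Z₂ / M
  ≲-+ (z₁ , ∣z₁∣≤Z₁ , p) (z₂ , ∣z₂∣≤Z₂ , q) =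
    z₁ ℤ.+ z₂ ,
    ℕ.≤-trans (ℤ.∣i+j∣≤∣i∣+∣j∣ z₁ z₂) (ℕ.+-mono-≤ ∣z₁∣≤Z₁ ∣z₂∣≤Z₂) ,
    ≐-+ p q

  ≲-neg : .{{NonZero M}} → x ≲ Z / M → ℚ.- x ≲ Z / M
  ≲-neg (z , ∣z∣≤Z , p) = ℤ.- z , subst (_≤ _) (sym (ℤ.∣-i∣≡∣i∣ z)) ∣z∣≤Z , ≐-neg p

  ≲-- : .{{NonZero M}} → x ≲ Z₁ / M → y ≲ Z₂ / M → x ℚ.- y ≲ Z₁ + Z₂ / M
  ≲-- p q = ≲-+ p (≲-neg q)

  ≲-*-ℕtoℚ : .{{NonZero M}} → x ≲ Z / M → x ℚ.* ℕtoℚ m ≲ Z * m / M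
  ≲-*-ℕtoℚ {M} {x} {Z} {m} (z , ∣z∣≤Z , p) =
    z ℤ.* + m ,
    subst (_≤ Z * m) (sym (ℤ.abs-* z (+ m))) (ℕ.*-monoˡ-≤ m ∣z∣≤Z) ,
    subst (λ N → x ℚ.* ℕtoℚ m ≐ z ℤ.* + m / N) (ℕ.*-identityʳ M) (≐-* p ℕtoℚ-≐)

  sumℚ-≲ : .{{NonZero M}} → (f : A → ℚ) {xs : List A} →
           All (λ a → f a ≲ Z / M) xs → sumℚ (map f xs) ≲ length xs * Z / M
  sumℚ-≲ f []       = + 0 , z≤n , 0ℚ-≐
  sumℚ-≲ f (p ∷ ps) = ≲-+ p (sumℚ-≲ f ps)

  bitLength-mono-≤ : ∀ {m n} → m ≤ n → bitLength m ≤ bitLength n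
  bitLength-mono-≤ m≤n = ⌈log₂⌉-mono-≤ (s≤s m≤n)

  bitLength-< : ∀ {m k} → m < 2 ^ k → bitLength m ≤ k
  bitLength-< {k = k} m<2^k = ℕ.≤-trans (⌈log₂⌉-mono-≤ m<2^k) (ℕ.≤-reflexive (⌈log₂2^n⌉≡n k))

  ≲-bits : .{{NonZero M}} → x ≲ Z / M → bits x ≤ bitLength Z + bitLength M
  ≲-bits (z , ∣z∣≤Z , p) = ℕ.+-mono-≤
    (bitLength-mono-≤ (ℕ.≤-trans (≐-numerator p) ∣z∣≤Z))
    (bitLength-mono-≤ (≐-denominator p))

open Fractions

length-∷ʳ : ∀ {A : Set} (w : List A) a → length (w ++ [ a ]) ≡ suc (length w)
length-∷ʳ w a = trans (length-++ w) (ℕ.+-comm (length w) 1)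

sum-map-*ʳ : ∀ {A : Set} (f : A → ℕ) k xs → sum (map (λ a → f a * k) xs) ≡ sum (map f xs) * k
sum-map-*ʳ f k []       = refl
sum-map-*ʳ f k (x ∷ xs) =
  trans (cong (λ s → f x * k + s) (sum-map-*ʳ f k xs)) (sym (ℕ.*-distribʳ-+ k (f x) (sum (map f xs))))

sum-map-filterᵇ-≤ : ∀ {A : Set} (f : A → ℕ) (p : A → Bool) xs →
                    sum (map f (filterᵇ p xs)) ≤ sum (map f xs)
sum-map-filterᵇ-≤ f p []       = z≤n
sum-map-filterᵇ-≤ f p (x ∷ xs) with p x
... | true  = ℕ.+-monoʳ-≤ (f x) (sum-map-filterᵇ-≤ f p xs)
... | false = ℕ.≤-trans (sum-map-filterᵇ-≤ f p xs) (ℕ.m≤n+m _ (f x))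

isPrefix-length : ∀ {n} (u v : Word n) → T (isPrefix u v) → length u ≤ length v
isPrefix-length []      v       _ = z≤n
isPrefix-length (x ∷ u) (y ∷ v) h = s≤s (isPrefix-length u v (proj₂ (Equivalence.to T-∧ h)))

isPrefixOfSome-length : ∀ {n D} (u : Word n) ds → All (λ d → length (proj₁ d) ≤ D) ds →
                        T (isPrefixOfSome u ds) → length u ≤ D
isPrefixOfSome-length u (d ∷ ds) (d≤D ∷ ds≤D) h with Equivalence.to T-∨ h
... | inj₁ u≼d   = ℕ.≤-trans (isPrefix-length u (proj₁ d) u≼d) d≤D
... | inj₂ u≼ds  = isPrefixOfSome-length u ds ds≤D u≼ds

n<2^n : ∀ n → n < 2 ^ n
n<2^n zero    = s≤s z≤n
n<2^n (suc n) = subst (suc n <_) (cong (λ m → 2 ^ n + m) (sym (ℕ.+-identityʳ (2 ^ n))))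
  (ℕ.+-mono-≤ (ℕ.m^n>0 2 n) (n<2^n n))

quadratic<2^ : ∀ D Z → .{{NonZero Z}} → D * Z + D * ((Z + Z) * D) < 2 ^ (1 + D + D) * Z
quadratic<2^ D Z = begin-strict
  D * Z + D * ((Z + Z) * D)  ≡⟨ factor D Z ⟩
  (D + 2 * (D * D)) * Z      <⟨ ℕ.*-monoˡ-< Z polynomial< ⟩
  2 ^ (1 + D + D) * Z        ∎
  where
  open ℕ.≤-Reasoning
  factor : ∀ D Z → D * Z + D * ((Z + Z) * D) ≡ (D + 2 * (D * D)) * Z
  factor = ℕ-Solver.solve-∀
  expand : ∀ D → 2 * (suc D * suc D) ≡ suc (D + 2 * (D * D)) + (3 * D + 1)
  expand = ℕ-Solver.solve-∀
  polynomial< : D + 2 * (D * D) < 2 ^ (1 + D + D)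
  polynomial< = begin-strict
    D + 2 * (D * D)      <⟨ ℕ.m≤m+n _ _ ⟩
    suc (D + 2 * (D * D)) + (3 * D + 1) ≡⟨ expand D ⟨
    2 * (suc D * suc D)  ≤⟨ ℕ.*-monoʳ-≤ 2 (ℕ.*-mono-≤ (n<2^n D) (n<2^n D)) ⟩
    2 * (2 ^ D * 2 ^ D)  ≡⟨ cong (2 *_) (ℕ.^-distribˡ-+-* 2 D D) ⟨
    2 ^ (1 + D + D)      ∎

bits-budget : ∀ b D → 1 ≤ b → 1 ≤ D → (1 + D + D + b * suc D) + suc (b * suc D) ≤ 8 * (D * b)
bits-budget (suc b) (suc d) _ _ = ℕ.≤-trans (ℕ.m≤m+n _ _) (ℕ.≤-reflexive (sym (expand b d)))
  where
  expand : ∀ b d → 8 * (suc d * suc b) ≡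
    (1 + suc d + suc d + suc b * suc (suc d)) + suc (suc b * suc (suc d)) + (6 * (d * b) + 4 * d + 4 * b)
  expand = ℕ-Solver.solve-∀

module _ {n : ℕ} (2≤n : 2 ≤ n) where

  private
    full-node-≥2 : ∀ {m} → (m ≤ᵇ n ∸ 2) ≡ false → (m ≤ n ∸ 2) ⊎ (m ≡ n) → 2 ≤ m
    full-node-≥2 m≰ᵇ (inj₁ m≤) = contradiction (subst T m≰ᵇ (ℕ.≤⇒≤ᵇ m≤)) λ ()
    full-node-≥2 m≰ᵇ (inj₂ refl) = 2≤n

  mutual
    dictNode-nonempty : ∀ (w : Word n) t → NonRootOK t → 1 ≤ length (dictNode w t)
    dictNode-nonempty w (node cs) (shape , _ , ok) with length cs ≤ᵇ n ∸ 2 in eq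
    ... | true  = s≤s z≤n
    ... | false = ℕ.≤-trans (ℕ.≤-trans (ℕ.n≤1+n 1) (full-node-≥2 eq shape)) (dictChildren-size w cs ok)

    dictChildren-size : ∀ (w : Word n) cs → AllOK cs → length cs ≤ length (dictChildren w cs)
    dictChildren-size w []             _          = z≤n
    dictChildren-size w ((a , t) ∷ cs) (okt , ok) = begin
      suc (length cs)
        ≤⟨ ℕ.+-mono-≤ (dictNode-nonempty (w ++ [ a ]) t okt) (dictChildren-size w cs ok) ⟩
      length (dictNode (w ++ [ a ]) t) + length (dictChildren w cs)
        ≡⟨ length-++ (dictNode (w ++ [ a ]) t) ⟨
      length (dictChildren w ((a , t) ∷ cs)) ∎
      where open ℕ.≤-Reasoning

    dictNode-depth : ∀ (w : Word n) t → NonRootOK t →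
      All (λ d → length (proj₁ d) < length w + length (dictNode w t)) (dictNode w t)
    dictNode-depth w (node cs) (shape , _ , ok) with length cs ≤ᵇ n ∸ 2 in eq
    ... | true  = ℕ.m<m+n (length w) (s≤s z≤n) ∷ codeword-node cs (dictChildren-depth w cs ok)
      where
      codeword-node : ∀ cs →
        All (λ d → length (proj₁ d) + length cs ≤ suc (length w + length (dictChildren w cs)))
            (dictChildren w cs) →
        All (λ d → length (proj₁ d) < length w + suc (length (dictChildren w cs))) (dictChildren w cs)
      codeword-node []       []    = []
      codeword-node (_ ∷ cs) depth = All.map (λ {d} le → begin
        suc (length (proj₁ d))                  ≤⟨ s≤s (ℕ.m≤m+n _ (length cs)) ⟩
        suc (length (proj₁ d) + length cs)      ≡⟨ ℕ.+-suc _ (length cs) ⟨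
        length (proj₁ d) + suc (length cs)      ≤⟨ le ⟩
        suc (length w + _)                      ≡⟨ ℕ.+-suc (length w) _ ⟨
        length w + suc _                        ∎) depth
        where open ℕ.≤-Reasoning
    ... | false = All.map (λ {d} le → s≤s⁻¹ (begin
        2 + length (proj₁ d)          ≤⟨ ℕ.+-monoˡ-≤ _ (full-node-≥2 eq shape) ⟩
        length cs + length (proj₁ d)  ≡⟨ ℕ.+-comm (length cs) _ ⟩
        length (proj₁ d) + length cs  ≤⟨ le ⟩
        suc (length w + _)            ∎)) (dictChildren-depth w cs ok)
      where open ℕ.≤-Reasoning

    dictChildren-depth : ∀ (w : Word n) cs → AllOK cs →
      All (λ d → length (proj₁ d) + length cs ≤ suc (length w + length (dictChildren w cs))) (dictChildren w cs)
    dictChildren-depth w []             _          = []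
    dictChildren-depth w ((a , t) ∷ cs) (okt , ok) =
      ++⁺ (All.map first-child (dictNode-depth (w ++ [ a ]) t okt))
          (All.map later-child (dictChildren-depth w cs ok))
      where
      open ℕ.≤-Reasoning
      Kₜ K K' : ℕ
      Kₜ = length (dictNode (w ++ [ a ]) t)
      K' = length (dictChildren w cs)
      K  = length (dictChildren w ((a , t) ∷ cs))
      K≡ : K ≡ Kₜ + K'
      K≡ = length-++ (dictNode (w ++ [ a ]) t)
      1≤Kₜ : 1 ≤ Kₜ
      1≤Kₜ = dictNode-nonempty (w ++ [ a ]) t okt

      first-child : ∀ {l} → l < length (w ++ [ a ]) + Kₜ → l + suc (length cs) ≤ suc (length w + K)
      first-child {l} l< = begin
        l + suc (length cs)               ≡⟨ ℕ.+-suc l (length cs) ⟩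
        suc l + length cs                 ≤⟨ ℕ.+-mono-≤ l< (dictChildren-size w cs ok) ⟩
        length (w ++ [ a ]) + Kₜ + K'     ≡⟨ cong (λ l → l + Kₜ + K') (length-∷ʳ w a) ⟩
        suc (length w + Kₜ + K')          ≡⟨ cong suc (ℕ.+-assoc (length w) Kₜ K') ⟩
        suc (length w + (Kₜ + K'))        ≡⟨ cong (λ k → suc (length w + k)) K≡ ⟨
        suc (length w + K)                ∎

      later-child : ∀ {l} → l + length cs ≤ suc (length w + K') → l + suc (length cs) ≤ suc (length w + K)
      later-child {l} l≤ = begin
        l + suc (length cs)           ≡⟨ ℕ.+-suc l (length cs) ⟩
        suc (l + length cs)           ≤⟨ s≤s l≤ ⟩
        suc (suc (length w + K'))     ≡⟨ cong suc (ℕ.+-suc (length w) K') ⟨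
        suc (length w + suc K')       ≤⟨ s≤s (ℕ.+-monoʳ-≤ (length w) (ℕ.+-monoˡ-≤ K' 1≤Kₜ)) ⟩
        suc (length w + (Kₜ + K'))    ≡⟨ cong (λ k → suc (length w + k)) K≡ ⟨
        suc (length w + K)            ∎

  dict-nonempty : ∀ {i} (t : Tree n) → IsParseTree i t → 1 ≤ numCodewords i t
  dict-nonempty {i} (node cs) (1≤|cs| , _ , _ , ok) with length cs <ᵇ n ∸ i
  ... | true  = s≤s z≤n
  ... | false = ℕ.≤-trans 1≤|cs| (dictChildren-size [] cs ok)

  private
    root-child : ∀ {l c K} → 1 ≤ c → l + c ≤ suc K → l ≤ K
    root-child {l} {c} {K} 1≤c le =
      s≤s⁻¹ (subst (_≤ suc K) (ℕ.+-comm l 1) (ℕ.≤-trans (ℕ.+-monoʳ-≤ l 1≤c) le))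

  dict-depth : ∀ {i} (t : Tree n) → IsParseTree i t →
               All (λ d → length (proj₁ d) ≤ numCodewords i t) (dict i t)
  dict-depth {i} (node cs) (1≤|cs| , _ , _ , ok) with length cs <ᵇ n ∸ i
  ... | true  =
    z≤n ∷ All.map (λ le → ℕ.m≤n⇒m≤1+n (root-child 1≤|cs| le)) (dictChildren-depth [] cs ok)
  ... | false = All.map (root-child 1≤|cs|) (dictChildren-depth [] cs ok)

module Probabilities {n} (b : ℕ) (P : Fin n → ℕ) where

  B : ℕ
  B = 2 ^ b

  instance
    B≢0 : NonZero B
    B≢0 = ℕ.m^n≢0 2 b

  pW-≐ : ∀ w → pW b P w ≐ + product (map P w) / B ^ length w
  pW-≐ []      = 1ℚ-≐
  pW-≐ (c ∷ w) = subst (λ z → pW b P (c ∷ w) ≐ z / B * B ^ length w)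
    (sym (ℤ.pos-* (P c) (product (map P w)))) (≐-* divℕ-≐ (pW-≐ w))
    where instance _ = ℕ.m^n≢0 B (length w)

  tailProb-≐ : ∀ i → tailProb b P i ≐ + tailSum P i / B
  tailProb-≐ i = sumℚ-≐ (prob b P) P
    (All.universal (λ _ → divℕ-≐) (filterᵇ (λ u → i ≤ᵇ toℕ u) (allFin n)))

module CommonDenominator {n} (b : ℕ) (P : Fin n → ℕ) (i : ℕ) {{_ : NonZero (tailSum P i)}} (D : ℕ)
  where

  open Probabilities b P

  Tᵢ M Z : ℕ
  Tᵢ = tailSum P i
  M = B ^ D * Tᵢ
  Z = B ^ suc D

  instance
    M≢0 : NonZero M
    M≢0 = ℕ.m*n≢0 (B ^ D) Tᵢ {{ℕ.m^n≢0 B D}}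

  -- B ^ D · p_W(w) when length w ≤ D
  pW-num : Word n → ℕ
  pW-num w = product (map P w) * B ^ (D ∸ length w)

  pWi-num : Word n → ℕ
  pWi-num []      = M
  pWi-num (c ∷ w) = P c * pW-num w

  B^l*B^[D∸l]≡B^D : ∀ {l} → l ≤ D → B ^ l * B ^ (D ∸ l) ≡ B ^ D
  B^l*B^[D∸l]≡B^D {l} l≤D = trans (sym (ℕ.^-distribˡ-+-* B l (D ∸ l))) (cong (B ^_) (ℕ.m+[n∸m]≡n l≤D))

  pWi-≐ : ∀ w → length w ≤ D → pWi b P i w ≐ + pWi-num w / M
  pWi-≐ []      _     = subst (λ m → 1ℚ ≐ + m / M) (ℕ.*-identityˡ M) (≐-expand M 1ℚ-≐)
  pWi-≐ (c ∷ w) 1+l≤D =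
    subst₂ (λ z N → pWi b P i (c ∷ w) ≐ z / N) numerator-eq denominator-eq
      (≐-rescale K (≐-* (pW-≐ (c ∷ w)) (inv-≐ (tailProb-≐ i))))
    where
    l = length w
    K = B ^ (D ∸ suc l)
    p = product (map P w)
    instance _ = ℕ.m^n≢0 B (suc l)
    open ≡-Reasoning
    numerator-eq : + (P c * p) ℤ.* + B ℤ.* + K ≡ + pWi-num (c ∷ w)
    numerator-eq = begin
      + (P c * p) ℤ.* + B ℤ.* + K   ≡⟨ cong (ℤ._* + K) (ℤ.pos-* (P c * p) B) ⟨
      + (P c * p * B) ℤ.* + K       ≡⟨ ℤ.pos-* (P c * p * B) K ⟨
      + (P c * p * B * K)           ≡⟨ cong +_ (reassoc (P c) p B K) ⟩
      + (P c * (p * (B * K)))       ≡⟨ cong (λ e → + (P c * (p * B ^ e))) (ℕ.+-∸-assoc 1 1+l≤D) ⟨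
      + pWi-num (c ∷ w)             ∎
      where
      reassoc : ∀ x y u v → x * y * u * v ≡ x * (y * (u * v))
      reassoc = ℕ-Solver.solve-∀
    denominator-eq : B ^ suc l * Tᵢ * K ≡ M
    denominator-eq = trans (swap (B ^ suc l) Tᵢ K) (cong (_* Tᵢ) (B^l*B^[D∸l]≡B^D 1+l≤D))
      where
      swap : ∀ x y u → x * y * u ≡ x * u * y
      swap = ℕ-Solver.solve-∀

  pWi-num-∷ʳ : ∀ w a → pWi-num (w ++ [ a ]) ≡ P a * pW-num w
  pWi-num-∷ʳ []      a = refl
  pWi-num-∷ʳ (c ∷ w) a = begin
    P c * (product (map P (w ++ [ a ])) * B ^ (D ∸ length (w ++ [ a ])))
      ≡⟨ cong₂ (λ x e → P c * (x * B ^ (D ∸ e))) product-∷ʳ (length-∷ʳ w a) ⟩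
    P c * (product (map P w) * (P a * 1) * B ^ (D ∸ suc (length w)))
      ≡⟨ reassoc (P c) (product (map P w)) (P a) (B ^ (D ∸ suc (length w))) ⟩
    P a * (P c * product (map P w) * B ^ (D ∸ suc (length w)))   ∎
    where
    open ≡-Reasoning
    product-∷ʳ : product (map P (w ++ [ a ])) ≡ product (map P w) * (P a * 1)
    product-∷ʳ = trans (cong product (map-++ P w [ a ])) (product-++ (map P w) [ P a ])
    reassoc : ∀ x y u v → x * (y * (u * 1) * v) ≡ u * (x * y * v)
    reassoc = ℕ-Solver.solve-∀

  module _ (P≤B : ∀ k → P k ≤ B) (ΣP≡B : sum (map P (allFin n)) ≡ B) where

    product-≤ : ∀ w → product (map P w) ≤ B ^ length w
    product-≤ []      = ℕ.≤-refl
    product-≤ (c ∷ w) = ℕ.*-mono-≤ (P≤B c) (product-≤ w)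

    pW-num-≤ : ∀ w → length w ≤ D → pW-num w ≤ B ^ D
    pW-num-≤ w l≤D =
      ℕ.≤-trans (ℕ.*-monoˡ-≤ _ (product-≤ w)) (ℕ.≤-reflexive (B^l*B^[D∸l]≡B^D l≤D))

    Tᵢ≤B : Tᵢ ≤ B
    Tᵢ≤B = subst (Tᵢ ≤_) ΣP≡B (sum-map-filterᵇ-≤ P (λ u → i ≤ᵇ toℕ u) (allFin n))

    pWi-num-≤ : ∀ w → length w ≤ D → pWi-num w ≤ Z
    pWi-num-≤ []      _     =
      ℕ.≤-trans (ℕ.*-monoʳ-≤ (B ^ D) Tᵢ≤B) (ℕ.≤-reflexive (ℕ.*-comm (B ^ D) B))
    pWi-num-≤ (c ∷ w) 1+l≤D = ℕ.*-mono-≤ (P≤B c) (pW-num-≤ w (ℕ.<⇒≤ 1+l≤D))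

    ≲-bits-budget : ∀ {x} → 1 ≤ b → 1 ≤ D → x ≲ D * Z + D * ((Z + Z) * D) / M → bits x ≤ 8 * (D * b)
    ≲-bits-budget {x} 1≤b 1≤D x≲ = begin
      bits x                                               ≤⟨ ≲-bits x≲ ⟩
      bitLength (D * Z + D * ((Z + Z) * D)) + bitLength M
        ≤⟨ ℕ.+-mono-≤ (bitLength-< numerator<) (bitLength-< M<) ⟩
      (1 + D + D + E) + suc E                              ≤⟨ bits-budget b D 1≤b 1≤D ⟩
      8 * (D * b)                                          ∎
      where
      open ℕ.≤-Reasoning
      E = b * suc D
      Z≡2^E : Z ≡ 2 ^ E
      Z≡2^E = ℕ.^-*-assoc 2 b (suc D)
      2^[1+D+D]*Z≡2^[1+D+D+E] : 2 ^ (1 + D + D) * Z ≡ 2 ^ (1 + D + D + E)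
      2^[1+D+D]*Z≡2^[1+D+D+E] =
        trans (cong (2 ^ (1 + D + D) *_) Z≡2^E) (sym (ℕ.^-distribˡ-+-* 2 (1 + D + D) E))
      numerator< : D * Z + D * ((Z + Z) * D) < 2 ^ (1 + D + D + E)
      numerator< = subst (D * Z + D * ((Z + Z) * D) <_) 2^[1+D+D]*Z≡2^[1+D+D+E]
        (quadratic<2^ D Z {{ℕ.m^n≢0 B (suc D)}})
      M< : M < 2 ^ suc E
      M< = ℕ.≤-trans (s≤s (subst (M ≤_) Z≡2^E (pWi-num-≤ [] z≤n)))
                     (ℕ.^-monoʳ-< 2 (s≤s (s≤s z≤n)) (ℕ.n<1+n E))

    module ParseTree (t : Tree n) (depth : All (λ d → length (proj₁ d) ≤ D) (dict i t))
             (size : numCodewords i t ≤ D) where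

      extensions : Word n → List (Fin n)
      extensions w = filterᵇ (λ a → isPrefixOfSome (w ++ [ a ]) (dict i t)) (allFin n)

      extensions-length : ∀ w → All (λ a → length (w ++ [ a ]) ≤ D) (extensions w)
      extensions-length w = All.map (λ {a} → isPrefixOfSome-length (w ++ [ a ]) (dict i t) depth)
        (all-filter (λ a → T? (isPrefixOfSome (w ++ [ a ]) (dict i t))) (allFin n))

      extensions-≲ : ∀ w → length w ≤ D →
        sumℚ (map (λ a → pWi b P i (w ++ [ a ])) (extensions w)) ≲ Z / M
      extensions-≲ w l≤D = ≲-weaken numerator-≤
        (≐⇒≲ (sumℚ-≐ _ (λ a → P a * pW-num w) (All.map extension-≐ (extensions-length w))))
        where
        open ℕ.≤-Reasoning
        extension-≐ : ∀ {a} → length (w ++ [ a ]) ≤ D → pWi b P i (w ++ [ a ]) ≐ + (P a * pW-num w) / M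
        extension-≐ {a} l≤D =
          subst (λ m → pWi b P i (w ++ [ a ]) ≐ + m / M) (pWi-num-∷ʳ w a) (pWi-≐ (w ++ [ a ]) l≤D)
        numerator-≤ : sum (map (λ a → P a * pW-num w) (extensions w)) ≤ Z
        numerator-≤ = begin
          sum (map (λ a → P a * pW-num w) (extensions w)) ≡⟨ sum-map-*ʳ P (pW-num w) (extensions w) ⟩
          sum (map P (extensions w)) * pW-num w           ≤⟨ ℕ.*-mono-≤ ΣP≤B (pW-num-≤ w l≤D) ⟩
          B * B ^ D                                        ∎
          where
          ΣP≤B : sum (map P (extensions w)) ≤ B
          ΣP≤B = subst (_ ≤_) ΣP≡B (sum-map-filterᵇ-≤ P _ (allFin n))

      pCi-≲ : ∀ w → length w ≤ D → pCi b P i t w ≲ Z + Z / M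
      pCi-≲ w l≤D = ≲-- (≲-weaken (pWi-num-≤ w l≤D) (≐⇒≲ (pWi-≐ w l≤D))) (extensions-≲ w l≤D)

      q-≲ : ∀ j → q b P i t j ≲ D * (Z + Z) / M
      q-≲ j = ≲-weaken (ℕ.*-monoˡ-≤ (Z + Z) (ℕ.≤-trans (length-filter _ (dict i t)) size))
        (sumℚ-≲ _ (filter⁺ _ (All.map (λ {d} → pCi-≲ (proj₁ d)) depth)))

      expectedLength-≲ : expectedLength b P i t ≲ D * ((Z + Z) * D) / M
      expectedLength-≲ =
        ≲-weaken (ℕ.*-monoˡ-≤ _ size) (sumℚ-≲ _ (All.map (λ {d} → term-≲ (proj₁ d)) depth))
        where
        term-≲ : ∀ w → length w ≤ D → pCi b P i t w ℚ.* ℕtoℚ (length w) ≲ (Z + Z) * D / M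
        term-≲ w l≤D = ≲-weaken (ℕ.*-monoʳ-≤ (Z + Z) l≤D) (≲-*-ℕtoℚ (pCi-≲ w l≤D))

      codewords-≲ : ℕtoℚ (numCodewords i t) ≲ D * Z / M
      codewords-≲ =
        ≲-weaken (ℕ.*-mono-≤ size (pWi-num-≤ [] z≤n)) (≐⇒≲ (≐-expand M (ℕtoℚ-≐ {numCodewords i t})))

      cost-≲ : cost b P i t ≲ D * Z + D * ((Z + Z) * D) / M
      cost-≲ = ≲-- codewords-≲ expectedLength-≲

      q-bits : 1 ≤ b → 1 ≤ D → ∀ j → bits (q b P i t j) ≤ 8 * (D * b)
      q-bits 1≤b 1≤D j = ≲-bits-budget 1≤b 1≤D (≲-weaken q-numerator≤ (q-≲ j))
        where
        q-numerator≤ : D * (Z + Z) ≤ D * Z + D * ((Z + Z) * D)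
        q-numerator≤ = ℕ.≤-trans (ℕ.*-monoʳ-≤ D (ℕ.m≤m*n (Z + Z) D {{>-nonZero 1≤D}})) (ℕ.m≤n+m _ _)

      cost-bits : 1 ≤ b → 1 ≤ D → bits (cost b P i t) ≤ 8 * (D * b)
      cost-bits 1≤b 1≤D = ≲-bits-budget 1≤b 1≤D cost-≲

lemma2 : Σ ℕ λ c →
    (n : ℕ) → 2 ≤ n →
    (b : ℕ) → 1 ≤ b →
    (P : Fin n → ℕ) →
    (∀ k → P k ≤ 2 ^ b) →
    sum (map P (allFin n)) ≡ 2 ^ b →
    (∀ k l → toℕ k ≤ toℕ l → P l ≤ P k) →
    (i : ℕ) → i ≤ n ∸ 2 →
    0 < tailSum P i →
    (t : Tree n) → IsParseTree i t →
    (D : ℕ) → numCodewords i t ≡ D →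
    ((j : ℕ) → j ≤ n ∸ 2 → bits (q b P i t j) ≤ c * (D * b))
    × bits (cost b P i t) ≤ c * (D * b)
lemma2 = 8 , λ n 2≤n b 1≤b P P≤B ΣP≡B _ i _ 0<Tᵢ t parse D codewords≡D →
  let depth = subst (λ K → All (λ d → length (proj₁ d) ≤ K) (dict i t)) codewords≡D
                    (dict-depth 2≤n t parse)
      1≤D   = subst (1 ≤_) codewords≡D (dict-nonempty 2≤n t parse)
      open CommonDenominator b P i {{>-nonZero 0<Tᵢ}} D
      open ParseTree P≤B ΣP≡B t depth (ℕ.≤-reflexive codewords≡D)
  in (λ j _ → q-bits 1≤b 1≤D j) , cost-bits 1≤b 1≤D
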